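{- Let $G=(V,E)$ be a 0/1-weighted graph, $k$ an integer, and $X\subseteq V$ an odd cycle transversal of $G$, and let $(A,B)$ be color classes of the bipartite graph $G-X$. For each $Y\subseteq X$, let $G_Y$ be the bipartite subgraph of $G$ with vertex set $V$, color classes $A\cup Y$ and $B\cup(X\setminus Y)$, and edge set $E_Y=\{\{u,v\}\in E : u\in A\cup Y,\ v\in B\cup (X\setminus Y)\}$ (with the same edge weights). Then $(G,k)$ is a yes-instance of BCPM if and only if $(G_Y,k)$ is a yes-instance of BCPM for some $Y\subseteq X$; and likewise $(G,k)$ is a yes-instance of EM if and only if $(G_Y,k)$ is a yes-instance of EM for some $Y\subseteq X$.
   Context: A 0/1-weighted graph has each edge of weight $0$ or $1$; the weight of an edge set is the sum of its edge weights. An odd cycle transversal of $G$ is a vertex set $X$ such that $G-X$ is bipartite. EM: given a 0/1-weighted graph $G$ and integer $k$, decide whether $G$ has a perfect matching of weight exactly $k$. BCPM: given a 0/1-weighted graph $G$ and integer $k$, decide whether $G$ has a perfect matching of weight $k'$ with $k'\le k$ and $k'\equiv k\pmod 2$. -}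

module Defs where

open import Data.Nat using (ℕ; _≤_; _<ᵇ_)
open import Data.Fin using (Fin; toℕ)
open import Data.Fin.Subset using (Subset; _∈_; _∉_)
open import Data.List using (map; allFin)
open import Data.Nat.ListAction using (sum)
open import Data.Bool using (if_then_else_)
open import Data.Integer using (ℤ; +_; _-_) renaming (_≤_ to _≤ℤ_)
open import Data.Integer.Divisibility using () renaming (_∣_ to _∣ℤ_)
open import Data.Product using (Σ; _×_; ∃)
open import Data.Sum using (_⊎_)
open import Relation.Nullary using (¬_)
open import Relation.Binary.PropositionalEquality using (_≡_)

-- A finite simple graph on vertex set Fin n with 0/1 edge weights.
-- E u v : "{u,v} is an edge"; w u v : weight of the edge {u,v} (only
-- relevant when E u v holds), always 0 or 1.
record WGraph (n : ℕ) : Set₁ where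
  field
    E      : Fin n → Fin n → Set
    E-sym  : ∀ {u v} → E u v → E v u
    E-irr  : ∀ {v} → ¬ E v v
    w      : Fin n → Fin n → ℕ
    w-sym  : ∀ u v → w u v ≡ w v u
    w-01   : ∀ u v → w u v ≤ 1
open WGraph public

-- A perfect matching: every vertex v is matched to mate v via an edge,
-- and mate is an involution (so the matched edges are pairwise disjoint
-- and cover V; mate v ≠ v follows from irreflexivity of E).
record PerfectMatching {n : ℕ} (G : WGraph n) : Set where
  field
    mate       : Fin n → Fin n
    mate-invol : ∀ v → mate (mate v) ≡ v
    mate-edge  : ∀ v → E G v (mate v)
open PerfectMatching public

-- Weight of a perfect matching: sum of the weights of its edges, each
-- edge {v, mate v} counted once (from its smaller endpoint).
weight : {n : ℕ} {G : WGraph n} → PerfectMatching G → ℕ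
weight {n} {G} M =
  sum (map (λ v → if toℕ v <ᵇ toℕ (mate M v) then w G v (mate M v) else 0)
           (allFin n))

EM : {n : ℕ} → WGraph n → ℤ → Set
EM G k = Σ (PerfectMatching G) λ M → + weight M ≡ k

BCPM : {n : ℕ} → WGraph n → ℤ → Set
BCPM G k = Σ (PerfectMatching G) λ M →
  (+ weight M ≤ℤ k) × ((+ 2) ∣ℤ (k - + weight M))

-- (A, B, X) partition V, and A, B are independent in G (i.e. A, B are
-- colour classes of the bipartite graph G - X; hence X is an OCT).
IsPartition : {n : ℕ} → Subset n → Subset n → Subset n → Set
IsPartition A B X = ∀ v →
    (v ∈ A × v ∉ B × v ∉ X)
  ⊎ (v ∉ A × v ∈ B × v ∉ X)
  ⊎ (v ∉ A × v ∉ B × v ∈ X)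

ColourClasses : {n : ℕ} → WGraph n → Subset n → Subset n → Subset n → Set
ColourClasses G X A B =
  IsPartition A B X
  × (∀ u v → E G u v → u ∈ A → v ∈ A → ⊥′)
  × (∀ u v → E G u v → u ∈ B → v ∈ B → ⊥′)
  where open import Data.Empty renaming (⊥ to ⊥′)

InAY : {n : ℕ} → Subset n → Subset n → Fin n → Set
InAY A Y v = v ∈ A ⊎ v ∈ Y

InBY : {n : ℕ} → Subset n → Subset n → Subset n → Fin n → Set
InBY B X Y v = v ∈ B ⊎ (v ∈ X × v ∉ Y)

G[_] : {n : ℕ} → WGraph n → Subset n → Subset n → Subset n → Subset n → WGraph n
G[_] G A B X Y = record
  { E     = λ u v → E G u v × ((InAY A Y u × InBY B X Y v) ⊎ (InAY A Y v × InBY B X Y u))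
  ; E-sym = λ { (e , s) → E-sym G e , swap s }
  ; E-irr = λ { (e , _) → E-irr G e }
  ; w     = w G
  ; w-sym = w-sym G
  ; w-01  = w-01 G
  }
  where
  open import Data.Product using (_,_)
  open import Data.Sum using (inj₁; inj₂)
  swap : ∀ {P Q : Set} → P ⊎ Q → Q ⊎ P
  swap (inj₁ p) = inj₂ p
  swap (inj₂ q) = inj₁ q

-- G_Y is a spanning subgraph of G with the same weights, so every
-- perfect matching of some G_Y is one of G of the same weight.  Conversely, given
-- a perfect matching M of G, orient each matching edge {u, m} by sending u to the
-- A-side when u ∈ A, or when u ∈ X and m lies in B, or in X with m > u; let Y be
-- the X-vertices sent to the A-side.  Because A and B are independent, every
-- matching edge has exactly one endpoint on the A-side, so M is a perfect
-- matching of G_Y, again of the same weight.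
module Submission where

open import Defs
open import Data.Nat using (ℕ)
open import Data.Integer using (ℤ; +_; _-_)
import Data.Integer as ℤ
open import Data.Integer.Divisibility using (_∣_)
open import Data.Fin using (Fin; _<_)
open import Data.Fin.Properties using (_<?_; <-cmp; <-asym)
open import Data.Fin.Subset using (Subset; _⊆_; _∈_; _∉_)
open import Data.Fin.Subset.Properties using (_∈?_)
open import Data.Vec using (tabulate)
open import Data.Vec.Properties using (lookup∘tabulate; lookup⇒[]=; []=⇒lookup)
open import Data.Product using (Σ; _×_; _,_; proj₁; proj₂)
open import Data.Sum using (_⊎_; inj₁; inj₂)
open import Data.Empty using (⊥; ⊥-elim)
open import Level using (0ℓ)
open import Function using (_∘_)
open import Function.Bundles using (_⇔_; mk⇔)
open import Relation.Unary using (Pred; Decidable)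
open import Relation.Nullary using (Dec; ¬_; yes; does; _×-dec_; _⊎-dec_)
open import Relation.Nullary.Decidable using (dec-true)
open import Relation.Binary using (tri<; tri≈; tri>)
open import Relation.Binary.PropositionalEquality using (_≡_; refl; sym; trans)

module _ {n : ℕ} {P : Pred (Fin n) 0ℓ} (P? : Decidable P) where

  subsetOf : Subset n
  subsetOf = tabulate (does ∘ P?)

  ∈-subsetOf⁺ : ∀ {v} → P v → v ∈ subsetOf
  ∈-subsetOf⁺ {v} p = lookup⇒[]= v subsetOf (trans (lookup∘tabulate _ v) (dec-true (P? v) p))

  ∈-subsetOf⁻ : ∀ {v} → v ∈ subsetOf → P v
  ∈-subsetOf⁻ {v} v∈ with P? v | trans (sym (lookup∘tabulate (does ∘ P?) v)) ([]=⇒lookup v∈)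
  ... | yes p | _ = p

module _ {n : ℕ} {A B X : Subset n} (partition : IsPartition A B X) where

  ∈A⇒∉B : ∀ {v} → v ∈ A → v ∉ B
  ∈A⇒∉B {v} v∈A with partition v
  ... | inj₁ (_ , v∉B , _)          = v∉B
  ... | inj₂ (inj₁ (v∉A , _ , _))   = ⊥-elim (v∉A v∈A)
  ... | inj₂ (inj₂ (v∉A , _ , _))   = ⊥-elim (v∉A v∈A)

  ∈A⇒∉X : ∀ {v} → v ∈ A → v ∉ X
  ∈A⇒∉X {v} v∈A with partition v
  ... | inj₁ (_ , _ , v∉X)          = v∉X
  ... | inj₂ (inj₁ (v∉A , _ , _))   = ⊥-elim (v∉A v∈A)
  ... | inj₂ (inj₂ (v∉A , _ , _))   = ⊥-elim (v∉A v∈A)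

  ∈B⇒∉X : ∀ {v} → v ∈ B → v ∉ X
  ∈B⇒∉X {v} v∈B with partition v
  ... | inj₁ (_ , v∉B , _)          = ⊥-elim (v∉B v∈B)
  ... | inj₂ (inj₁ (_ , _ , v∉X))   = v∉X
  ... | inj₂ (inj₂ (_ , v∉B , _))   = ⊥-elim (v∉B v∈B)

Crosses : {n : ℕ} → Subset n → Subset n → Subset n → Subset n → Fin n → Fin n → Set
Crosses A B X Y u v = (InAY A Y u × InBY B X Y v) ⊎ (InAY A Y v × InBY B X Y u)

module _ {n : ℕ} (G : WGraph n) (A B X Y : Subset n) where

  restrict : (M : PerfectMatching G) → (∀ v → Crosses A B X Y v (mate M v)) →
             PerfectMatching (G[ G ] A B X Y)
  restrict M crosses = record
    { mate       = mate M
    ; mate-invol = mate-invol M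
    ; mate-edge  = λ v → mate-edge M v , crosses v
    }

  forget : PerfectMatching (G[ G ] A B X Y) → PerfectMatching G
  forget M = record
    { mate       = mate M
    ; mate-invol = mate-invol M
    ; mate-edge  = proj₁ ∘ mate-edge M
    }

module Orientation {n : ℕ} (G : WGraph n) (X A B : Subset n)
                   (cc : ColourClasses G X A B) where

  private
    partition : IsPartition A B X
    partition = proj₁ cc

    A-independent : ∀ u v → E G u v → u ∈ A → v ∈ A → ⊥
    A-independent = proj₁ (proj₂ cc)

    B-independent : ∀ u v → E G u v → u ∈ B → v ∈ B → ⊥
    B-independent = proj₂ (proj₂ cc)

  AEnd : Fin n → Fin n → Set
  AEnd u m = u ∈ A ⊎ (u ∈ X × (m ∈ B ⊎ (m ∈ X × u < m)))

  AEnd? : ∀ u m → Dec (AEnd u m)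
  AEnd? u m = (u ∈? A) ⊎-dec ((u ∈? X) ×-dec ((m ∈? B) ⊎-dec ((m ∈? X) ×-dec (u <? m))))

  AEnd-total : ∀ {u m} → E G u m → AEnd u m ⊎ AEnd m u
  AEnd-total {u} {m} e with partition u | partition m
  ... | inj₁ (u∈A , _ , _)        | _                           = inj₁ (inj₁ u∈A)
  ... | inj₂ _                    | inj₁ (m∈A , _ , _)          = inj₂ (inj₁ m∈A)
  ... | inj₂ (inj₁ (_ , u∈B , _)) | inj₂ (inj₁ (_ , m∈B , _))  = ⊥-elim (B-independent u m e u∈B m∈B)
  ... | inj₂ (inj₁ (_ , u∈B , _)) | inj₂ (inj₂ (_ , _ , m∈X))  = inj₂ (inj₂ (m∈X , inj₁ u∈B))
  ... | inj₂ (inj₂ (_ , _ , u∈X)) | inj₂ (inj₁ (_ , m∈B , _))  = inj₁ (inj₂ (u∈X , inj₁ m∈B))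
  ... | inj₂ (inj₂ (_ , _ , u∈X)) | inj₂ (inj₂ (_ , _ , m∈X)) with <-cmp u m
  ...   | tri< u<m _ _ = inj₁ (inj₂ (u∈X , inj₂ (m∈X , u<m)))
  ...   | tri> _ _ m<u = inj₂ (inj₂ (m∈X , inj₂ (u∈X , m<u)))
  ...   | tri≈ _ refl _ = ⊥-elim (E-irr G e)

  AEnd-unique : ∀ {u m} → E G u m → AEnd u m → ¬ AEnd m u
  AEnd-unique e (inj₁ u∈A) (inj₁ m∈A) = A-independent _ _ e u∈A m∈A
  AEnd-unique e (inj₁ u∈A) (inj₂ (_ , inj₁ u∈B)) = ∈A⇒∉B partition u∈A u∈B
  AEnd-unique e (inj₁ u∈A) (inj₂ (_ , inj₂ (u∈X , _))) = ∈A⇒∉X partition u∈A u∈X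
  AEnd-unique e (inj₂ (_ , inj₁ m∈B)) (inj₁ m∈A) = ∈A⇒∉B partition m∈A m∈B
  AEnd-unique e (inj₂ (_ , inj₂ (m∈X , _))) (inj₁ m∈A) = ∈A⇒∉X partition m∈A m∈X
  AEnd-unique e (inj₂ (_ , inj₁ m∈B)) (inj₂ (m∈X , _)) = ∈B⇒∉X partition m∈B m∈X
  AEnd-unique e (inj₂ (u∈X , _)) (inj₂ (_ , inj₁ u∈B)) = ∈B⇒∉X partition u∈B u∈X
  AEnd-unique e (inj₂ (_ , inj₂ (_ , u<m))) (inj₂ (_ , inj₂ (_ , m<u))) = <-asym u<m m<u

  module _ (M : PerfectMatching G) where

    InY : Pred (Fin n) 0ℓ
    InY v = v ∈ X × AEnd v (mate M v)

    InY? : Decidable InY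
    InY? v = (v ∈? X) ×-dec AEnd? v (mate M v)

    Y : Subset n
    Y = subsetOf InY?

    Y⊆X : Y ⊆ X
    Y⊆X = proj₁ ∘ ∈-subsetOf⁻ InY?

    AEnd⇒InAY : ∀ {u m} → mate M u ≡ m → AEnd u m → InAY A Y u
    AEnd⇒InAY refl (inj₁ u∈A)            = inj₁ u∈A
    AEnd⇒InAY refl u-end@(inj₂ (u∈X , _)) = inj₂ (∈-subsetOf⁺ InY? (u∈X , u-end))

    ¬AEnd⇒InBY : ∀ {u m} → mate M u ≡ m → ¬ AEnd u m → InBY B X Y u
    ¬AEnd⇒InBY {u} refl ¬u-end with partition u
    ... | inj₁ (u∈A , _ , _)        = ⊥-elim (¬u-end (inj₁ u∈A))
    ... | inj₂ (inj₁ (_ , u∈B , _)) = inj₁ u∈B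
    ... | inj₂ (inj₂ (_ , _ , u∈X)) = inj₂ (u∈X , ¬u-end ∘ proj₂ ∘ ∈-subsetOf⁻ InY?)

    matching-crosses : ∀ v → Crosses A B X Y v (mate M v)
    matching-crosses v with AEnd-total (mate-edge M v)
    ... | inj₁ v-end = inj₁ ( AEnd⇒InAY refl v-end
                            , ¬AEnd⇒InBY (mate-invol M v) (AEnd-unique (mate-edge M v) v-end))
    ... | inj₂ m-end = inj₂ ( AEnd⇒InAY (mate-invol M v) m-end
                            , ¬AEnd⇒InBY refl (λ v-end → AEnd-unique (mate-edge M v) v-end m-end))

  perfectMatching⇔someG[Y] : (Q : ℕ → Set) →
    Σ (PerfectMatching G) (Q ∘ weight) ⇔
    Σ (Subset n) (λ Y → Y ⊆ X × Σ (PerfectMatching (G[ G ] A B X Y)) (Q ∘ weight))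
  -- restrict and forget keep mate and w, so the weight is unchanged definitionally.
  perfectMatching⇔someG[Y] Q = mk⇔
    (λ (M , q) → Y M , Y⊆X M , restrict G A B X (Y M) M (matching-crosses M) , q)
    (λ (Y , _ , M , q) → forget G A B X Y M , q)

lemma3p1 : (n : ℕ) (G : WGraph n) (k : ℤ) (X A B : Subset n) →
    ColourClasses G X A B →
    (BCPM G k ⇔ Σ (Subset n) (λ Y → Y ⊆ X × BCPM (G[ G ] A B X Y) k))
    × (EM G k ⇔ Σ (Subset n) (λ Y → Y ⊆ X × EM (G[ G ] A B X Y) k))
lemma3p1 n G k X A B cc =
  perfectMatching⇔someG[Y] (λ w → (+ w ℤ.≤ k) × (+ 2 ∣ k - + w)) ,
  perfectMatching⇔someG[Y] (λ w → + w ≡ k)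
  where open Orientation G X A B cc
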